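{- Let $\mathscr{P}_{T_{\mathrm{II}}}$ be the set of partitions $\lambda_1\ge\lambda_2\ge\cdots\ge\lambda_\ell\ge1$ (empty partition included) with $\lambda_i-\lambda_{i+2}\ge 3$ for all applicable $i$, and such that $\lambda_i-\lambda_{i+1}\le 1$ implies $\lambda_i+\lambda_{i+1}\equiv 2\pmod 3$. Let $G(x)=G(x,q)=\sum_{\lambda}x^{\sharp(\lambda)}q^{|\lambda|}$ over those $\lambda\in\mathscr{P}_{T_{\mathrm{II}}}$ whose smallest part is at least $2$ (empty partition included), where $\sharp(\lambda)$ is the number of parts and $|\lambda|$ the sum of parts. Then $$p_0(x,q)G(x)+p_3(x,q)G(xq^3)+p_6(x,q)G(xq^6)+p_9(x,q)G(xq^9)=0,$$ where \begin{align*} p_0&=1+x(q^5+q^7),\\ p_3&=-1-x(q^2+q^3+q^4+q^5+q^7)-x^2(q^5+q^6+q^7+2q^8+q^9+q^{10}+q^{11})-x^3(q^{10}+q^{12}+q^{13}+q^{15}),\\ p_6&=x^3(q^{14}+q^{16})+x^4(q^{18}+q^{19}+q^{20}+q^{21}+q^{22})+x^5(q^{24}+q^{26}),\\ p_9&=x^5q^{32}+x^6(q^{34}+q^{36}). \end{align*} -}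

module Defs where

open import Data.Nat using (ℕ; zero; suc; _+_; _*_; _∸_; _≤_; _≤?_; _≤ᵇ_; _≟_)
open import Data.Nat.DivMod using (_%_)
open import Data.Bool using (if_then_else_; _∧_)
open import Data.Integer as ℤ using (ℤ; +_; -_; 0ℤ)
open import Data.List using (List; []; _∷_; length; filter; map; concatMap; upTo; foldr)
open import Data.Nat.ListAction using (sum)
open import Data.List.Relation.Unary.All using (All; all?)
open import Data.List.Relation.Unary.Linked using (Linked; linked?)
open import Data.Product using (_×_; _,_)
open import Data.Unit using (⊤; tt)
open import Relation.Binary.PropositionalEquality using (_≡_)
open import Relation.Nullary using (Dec; yes; no; _×-dec_; _→-dec_)

IsPartition : List ℕ → Set
IsPartition ls = Linked (λ x y → y ≤ x) ls × All (1 ≤_) ls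

Gap2 : List ℕ → Set
Gap2 (x ∷ y ∷ z ∷ r) = (3 + z ≤ x) × Gap2 (y ∷ z ∷ r)
Gap2 _ = ⊤

gap2? : (ls : List ℕ) → Dec (Gap2 ls)
gap2? (x ∷ y ∷ z ∷ r) = (3 + z ≤? x) ×-dec gap2? (y ∷ z ∷ r)
gap2? [] = yes tt
gap2? (x ∷ []) = yes tt
gap2? (x ∷ y ∷ []) = yes tt

CongCond : ℕ → ℕ → Set
CongCond x y = x ∸ y ≤ 1 → (x + y) % 3 ≡ 2

InPTII : List ℕ → Set
InPTII ls = IsPartition ls × Gap2 ls × Linked CongCond ls

InG : List ℕ → Set
InG ls = InPTII ls × All (2 ≤_) ls

inG? : (ls : List ℕ) → Dec (InG ls)
inG? ls =
  ((linked? (λ x y → y ≤? x) ls ×-dec all? (1 ≤?_) ls)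
    ×-dec gap2? ls
    ×-dec linked? (λ x y → (x ∸ y ≤? 1) →-dec ((x + y) % 3 ≟ 2)) ls)
  ×-dec all? (2 ≤?_) ls

lists : ℕ → ℕ → List (List ℕ)
lists zero    b = [] ∷ []
lists (suc a) b = concatMap (λ x → map (x ∷_) (lists a b)) (upTo (suc b))

-- g a b = number of λ counted by G with ♯(λ) = a and |λ| = b
-- (any such λ has length a and all parts ≤ b, so appears in  lists a b)
gCoef : ℕ → ℕ → ℕ
gCoef a b = length (filter (λ ls → (sum ls ≟ b) ×-dec inG? ls) (lists a b))

-- coefficient of x^m q^n in G(x q^k) = Σ g(m',n') x^{m'} q^{n' + k m'}
shiftCoef : ℕ → ℕ → ℕ → ℤ
shiftCoef k m n = if k * m ≤ᵇ n then + gCoef m (n ∸ k * m) else 0ℤ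

-- polynomials in x, q with integer coefficients: list of terms c · x^i q^j,
-- encoded as (c , i , j)
Poly : Set
Poly = List (ℤ × ℕ × ℕ)

prodCoef : Poly → ℕ → ℕ → ℕ → ℤ
prodCoef p k a b = foldr ℤ._+_ 0ℤ (map term p)
  where
  term : ℤ × ℕ × ℕ → ℤ
  term (c , i , j) = if (i ≤ᵇ a) ∧ (j ≤ᵇ b) then c ℤ.* shiftCoef k (a ∸ i) (b ∸ j) else 0ℤ

private
  t : ℤ → ℕ → ℕ → ℤ × ℕ × ℕ
  t c i j = (c , i , j)

  one : ℤ
  one = + 1

  mone : ℤ
  mone = - (+ 1)

p₀ : Poly
p₀ = t one 0 0 ∷ t one 1 5 ∷ t one 1 7 ∷ []

p₃ : Poly
p₃ = t mone 0 0
   ∷ t mone 1 2 ∷ t mone 1 3 ∷ t mone 1 4 ∷ t mone 1 5 ∷ t mone 1 7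
   ∷ t mone 2 5 ∷ t mone 2 6 ∷ t mone 2 7 ∷ t (- (+ 2)) 2 8 ∷ t mone 2 9 ∷ t mone 2 10 ∷ t mone 2 11
   ∷ t mone 3 10 ∷ t mone 3 12 ∷ t mone 3 13 ∷ t mone 3 15 ∷ []

p₆ : Poly
p₆ = t one 3 14 ∷ t one 3 16
   ∷ t one 4 18 ∷ t one 4 19 ∷ t one 4 20 ∷ t one 4 21 ∷ t one 4 22
   ∷ t one 5 24 ∷ t one 5 26 ∷ []

p₉ : Poly
p₉ = t one 5 32 ∷ t one 6 34 ∷ t one 6 36 ∷ []

module Submission where

-- G(x) is the generating function of the partitions in 𝒫_{T_II} with smallest
-- part ≥ 2.  Following the paper, such a partition is read from its smallest
-- part upwards, and A_k denotes the generating function of these increasing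
-- sequences with all parts ≥ k (`Asc k`), so that G = A₂ (`gCoef≡Asc`).
--
-- Splitting off the smallest part k and examining which parts may follow it
-- (only the next parts k, k + 1, k + 2 are constrained, according to k mod 3)
-- gives
--   A_k = A_{k+1} + x q^k A_{k+2}                                      (k ≡ 0),
--   A_k = A_{k+1} + x q^k A_{k+2} + x² q^{2k} A_{k+3}                   (k ≡ 1),
--   A_k = A_{k+1} + x q^k A_{k+3} + x² q^{2k+1} A_{k+3} + x² q^{2k+2} A_{k+4}
--                                                                      (k ≡ 2),
-- (`recurrence-sound`), while subtracting 3 from every part shows
-- A_{k+3}(x) = A_k(x q³) (`Asc-shift`), so G(x q^{3t}) = A_{3t+2}.  The
-- functional equation is then the linear relation p₀ A₂ + p₃ A₅ + p₆ A₈ +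
-- p₉ A₁₁ = 0, which follows from the recurrences by eliminating A₂, A₃, A₄,
-- A₅, A₆, A₇, A₉: the generic module `LinearRelations` checks by computation
-- that this elimination leaves only zero coefficients.

module Proof where

  open import Defs
  open import Data.Nat using (ℕ; zero; suc; _+_; _*_; _∸_; _≤_; _<_; _≤?_; _≤ᵇ_; _≡ᵇ_; _≟_; z≤n; s≤s)
  open import Data.Nat.Properties
  open import Data.Nat.DivMod using (_%_; %-distribˡ-+; m%n<n; m%n%n≡m%n; [m+kn]%n≡m%n)
  open import Data.Nat.ListAction using (sum)
  open import Data.Nat.ListAction.Properties using (sum-↭)
  open import Data.Nat.Tactic.RingSolver using (solve-∀)
  open import Data.Integer using (ℤ; 0ℤ) renaming (+_ to pos; _+_ to _+ℤ_; _*_ to _*ℤ_)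
  import Data.Integer as ℤ
  import Data.Integer.Properties as ℤP
  import Data.Integer.Tactic.RingSolver as ℤ-Solver
  open import Data.Bool using (Bool; true; false; _∧_; _∨_; not; if_then_else_)
  open import Data.Bool.Properties using (∧-zeroʳ)
  open import Data.Empty using (⊥-elim)
  open import Data.List using (List; []; _∷_; _++_; _∷ʳ_; map; concatMap; applyUpTo; length; filter; reverse)
  open import Data.List.Base using (reverseAcc)
  open import Data.List.Properties using (unfold-reverse)
  open import Data.List.Relation.Unary.All using (All; []; _∷_; all?)
  open import Data.List.Relation.Unary.Linked using ([]; [-]; _∷_)
  open import Data.List.Relation.Binary.Permutation.Propositional.Properties using (↭-reverse)
  open import Data.Product using (_×_; _,_; proj₁)
  open import Data.Product.Properties using (≡-dec)
  open import Data.Unit using (⊤; tt)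
  open import Function using (_∘_; id; case_of_)
  open import Function.Bundles using (_⇔_; mk⇔; Equivalence)
  open import Level using (Level)
  open import Relation.Binary.Definitions using (tri<; tri≈; tri>)
  open import Relation.Binary.PropositionalEquality
  open import Relation.Nullary using (Dec; yes; no; does; ¬_; _×-dec_; _→-dec_)
  open import Relation.Nullary.Decidable using (does-⇔; dec-true; dec-false; toWitness)
  open import Relation.Unary using (Pred; Decidable)

  ≤ᵇ-yes : ∀ {m n} → m ≤ n → (m ≤ᵇ n) ≡ true
  ≤ᵇ-yes = dec-true (_ ≤? _)

  ≤ᵇ-no : ∀ {m n} → ¬ m ≤ n → (m ≤ᵇ n) ≡ false
  ≤ᵇ-no = dec-false (_ ≤? _)

  ≤ᵇ-suc : ∀ m n → (suc m ≤ᵇ suc n) ≡ (m ≤ᵇ n)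
  ≤ᵇ-suc zero    n = refl
  ≤ᵇ-suc (suc m) n = refl

  ≤ᵇ-3+ : ∀ a b → (3 + a ≤ᵇ 3 + b) ≡ (a ≤ᵇ b)
  ≤ᵇ-3+ a b = trans (≤ᵇ-suc (2 + a) (2 + b)) (trans (≤ᵇ-suc (1 + a) (1 + b)) (≤ᵇ-suc a b))

  +ʳ-≤ᵇ : ∀ d e x → (d + x ≤ᵇ e + x) ≡ (d ≤ᵇ e)
  +ʳ-≤ᵇ d e x = does-⇔ (mk⇔ (+-cancelʳ-≤ x d e) (+-monoˡ-≤ x)) (d + x ≤? e + x) (d ≤? e)

  ∸-≤ᵇ : ∀ a b n → a ≤ n → (b ≤ᵇ n ∸ a) ≡ (a + b ≤ᵇ n)
  ∸-≤ᵇ a b n a≤n =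
    does-⇔ (mk⇔ (λ b≤n∸a → subst (_≤ n) (+-comm b a) (m≤o∸n⇒m+n≤o b a≤n b≤n∸a))
                (λ a+b≤n → m+n≤o⇒m≤o∸n b (subst (_≤ n) (+-comm a b) a+b≤n)))
           (b ≤? n ∸ a) (a + b ≤? n)

  ≡ᵇ-yes : ∀ n → (n ≡ᵇ n) ≡ true
  ≡ᵇ-yes n = dec-true (n ≟ n) refl

  ≡ᵇ-no : ∀ {m n} → m ≢ n → (m ≡ᵇ n) ≡ false
  ≡ᵇ-no = dec-false (_ ≟ _)

  +ʳ-≡ᵇ : ∀ d e x → (d + x ≡ᵇ e + x) ≡ (d ≡ᵇ e)
  +ʳ-≡ᵇ d e x = does-⇔ (mk⇔ (+-cancelʳ-≡ x d e) (cong (_+ x))) (d + x ≟ e + x) (d ≟ e)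

  +≡ᵇ-∸ : ∀ y r t → y ≤ r → (y + t ≡ᵇ r) ≡ (t ≡ᵇ r ∸ y)
  +≡ᵇ-∸ zero    r       t _         = refl
  +≡ᵇ-∸ (suc y) (suc r) t (s≤s y≤r) = +≡ᵇ-∸ y r t y≤r

  +≡ᵇ-over : ∀ y r t → r < y → (y + t ≡ᵇ r) ≡ false
  +≡ᵇ-over (suc y) zero    t _         = refl
  +≡ᵇ-over (suc y) (suc r) t (s≤s r<y) = +≡ᵇ-over y r t r<y

  ∸-swap : ∀ r y z → r ∸ y ∸ z ≡ r ∸ z ∸ y
  ∸-swap r y z = trans (∸-+-assoc r y z) (trans (cong (r ∸_) (+-comm y z)) (sym (∸-+-assoc r z y)))

  Σ≤ : ℕ → (ℕ → ℕ) → ℕ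
  Σ≤ zero    f = f 0
  Σ≤ (suc n) f = f 0 + Σ≤ n (f ∘ suc)

  Σ-cong : ∀ n {f g : ℕ → ℕ} → (∀ y → y ≤ n → f y ≡ g y) → Σ≤ n f ≡ Σ≤ n g
  Σ-cong zero    h = h 0 z≤n
  Σ-cong (suc n) h = cong₂ _+_ (h 0 z≤n) (Σ-cong n (λ y y≤n → h (suc y) (s≤s y≤n)))

  Σ-+ : ∀ n (f g : ℕ → ℕ) → Σ≤ n (λ y → f y + g y) ≡ Σ≤ n f + Σ≤ n g
  Σ-+ zero    f g = refl
  Σ-+ (suc n) f g rewrite Σ-+ n (f ∘ suc) (g ∘ suc) = interchange (f 0) (g 0) _ _
    where
    interchange : ∀ a b c d → a + b + (c + d) ≡ a + c + (b + d)
    interchange = solve-∀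

  Σ-swap : ∀ n m (g : ℕ → ℕ → ℕ) → Σ≤ n (λ x → Σ≤ m (g x)) ≡ Σ≤ m (λ y → Σ≤ n (λ x → g x y))
  Σ-swap zero    m g = refl
  Σ-swap (suc n) m g = begin
    Σ≤ m (g 0) + Σ≤ n (λ x → Σ≤ m (g (suc x)))      ≡⟨ cong (Σ≤ m (g 0) +_) (Σ-swap n m (g ∘ suc)) ⟩
    Σ≤ m (g 0) + Σ≤ m (λ y → Σ≤ n (λ x → g (suc x) y)) ≡⟨ Σ-+ m (g 0) _ ⟨
    Σ≤ m (λ y → Σ≤ (suc n) (λ x → g x y))            ∎
    where open ≡-Reasoning

  Σ-vanish : ∀ n {f : ℕ → ℕ} → (∀ y → y ≤ n → f y ≡ 0) → Σ≤ n f ≡ 0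
  Σ-vanish zero    h = h 0 z≤n
  Σ-vanish (suc n) h = cong₂ _+_ (h 0 z≤n) (Σ-vanish n (λ y y≤n → h (suc y) (s≤s y≤n)))

  Σ-truncate : ∀ n N {f : ℕ → ℕ} → n ≤ N → (∀ y → n < y → f y ≡ 0) → Σ≤ N f ≡ Σ≤ n f
  Σ-truncate zero    zero    _         h = refl
  Σ-truncate zero    (suc N) {f} _     h =
    trans (cong (f 0 +_) (Σ-vanish N (λ y _ → h (suc y) (s≤s z≤n)))) (+-identityʳ (f 0))
  Σ-truncate (suc n) (suc N) {f} (s≤s n≤N) h =
    cong (f 0 +_) (Σ-truncate n N n≤N (λ y n<y → h (suc y) (s≤s n<y)))

  Σ-single : ∀ n k (F : ℕ → ℕ) → Σ≤ n (λ y → if y ≡ᵇ k then F y else 0) ≡ (if k ≤ᵇ n then F k else 0)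
  Σ-single zero    zero    F = refl
  Σ-single zero    (suc k) F = refl
  Σ-single (suc n) zero    F = trans (cong (F 0 +_) (Σ-vanish n (λ _ _ → refl))) (+-identityʳ (F 0))
  Σ-single (suc n) (suc k) F = trans (Σ-single n k (λ y → F (suc y))) (cong (λ c → if c then F (suc k) else 0) (sym (≤ᵇ-suc k n)))

  -- Pulling a common factor q^z out of a sum over the first part y.
  Σ-delay : ∀ r z (g : ℕ → Bool) (F : ℕ → ℕ → ℕ) →
    Σ≤ r (λ y → if (y ≤ᵇ r) ∧ g y then (if z ≤ᵇ r ∸ y then F y (r ∸ y ∸ z) else 0) else 0)
      ≡ (if z ≤ᵇ r then Σ≤ (r ∸ z) (λ y → if (y ≤ᵇ r ∸ z) ∧ g y then F y (r ∸ z ∸ y) else 0) else 0)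
  Σ-delay r z g F = trans (Σ-cong r fits) reindex
    where
    H : ℕ → ℕ
    H y = if (y + z ≤ᵇ r) ∧ g y then F y (r ∸ z ∸ y) else 0
    H-vanishes : ∀ y → ¬ (y + z ≤ r) → H y ≡ 0
    H-vanishes y y+z≰r rewrite ≤ᵇ-no y+z≰r = refl
    fits : ∀ y → y ≤ r → (if (y ≤ᵇ r) ∧ g y then (if z ≤ᵇ r ∸ y then F y (r ∸ y ∸ z) else 0) else 0) ≡ H y
    fits y y≤r rewrite ≤ᵇ-yes y≤r | ∸-≤ᵇ y z r y≤r | ∸-swap r y z with y + z ≤ᵇ r | g y
    ... | true  | true  = refl
    ... | true  | false = refl
    ... | false | true  = refl
    ... | false | false = refl
    reindex : Σ≤ r H ≡ (if z ≤ᵇ r then Σ≤ (r ∸ z) (λ y → if (y ≤ᵇ r ∸ z) ∧ g y then F y (r ∸ z ∸ y) else 0) else 0)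
    reindex with z ≤? r
    ... | yes z≤r rewrite ≤ᵇ-yes z≤r =
      trans (Σ-truncate (r ∸ z) r (m∸n≤m r z) (λ y r∸z<y → H-vanishes y (λ y+z≤r → <⇒≱ r∸z<y (m+n≤o⇒m≤o∸n y y+z≤r))))
            (Σ-cong (r ∸ z) (λ y y≤r∸z → cong (λ c → if c ∧ g y then F y (r ∸ z ∸ y) else 0)
                                              (trans (≤ᵇ-yes (m≤o∸n⇒m+n≤o y z≤r y≤r∸z)) (sym (≤ᵇ-yes y≤r∸z)))))
    ... | no  z≰r rewrite ≤ᵇ-no z≰r = Σ-vanish r (λ y _ → H-vanishes y (λ y+z≤r → z≰r (m+n≤o⇒n≤o y y+z≤r)))

  count : {A : Set} → (A → Bool) → List A → ℕ
  count f []       = 0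
  count f (x ∷ xs) = (if f x then 1 else 0) + count f xs

  count-filter : {A : Set} {ℓ : Level} {P : Pred A ℓ} (P? : Decidable P) (xs : List A) →
                 length (filter P? xs) ≡ count (does ∘ P?) xs
  count-filter P? []       = refl
  count-filter P? (x ∷ xs) with does (P? x)
  ... | true  = cong suc (count-filter P? xs)
  ... | false = count-filter P? xs

  count-cong : {A : Set} {f g : A → Bool} (xs : List A) → (∀ x → f x ≡ g x) → count f xs ≡ count g xs
  count-cong []       h = refl
  count-cong (x ∷ xs) h = cong₂ _+_ (cong (λ b → if b then 1 else 0) (h x)) (count-cong xs h)

  count-none : {A : Set} {f : A → Bool} (xs : List A) → (∀ x → f x ≡ false) → count f xs ≡ 0
  count-none []       h = refl
  count-none (x ∷ xs) h rewrite h x = count-none xs h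

  count-guard : {A : Set} (Q R : A → Bool) (c : Bool) (xs : List A) →
                count (λ l → Q l ∧ (c ∧ R l)) xs ≡ (if c then count (λ l → Q l ∧ R l) xs else 0)
  count-guard Q R true  xs = refl
  count-guard Q R false xs = count-none xs (λ l → ∧-zeroʳ (Q l))

  count-++ : {A : Set} (f : A → Bool) (xs ys : List A) → count f (xs ++ ys) ≡ count f xs + count f ys
  count-++ f []       ys = refl
  count-++ f (x ∷ xs) ys rewrite count-++ f xs ys = sym (+-assoc (if f x then 1 else 0) (count f xs) (count f ys))

  count-map : {A B : Set} (f : B → Bool) (h : A → B) (xs : List A) → count f (map h xs) ≡ count (f ∘ h) xs
  count-map f h []       = refl
  count-map f h (x ∷ xs) = cong ((if f (h x) then 1 else 0) +_) (count-map f h xs)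

  count-concatMap-upTo : {B : Set} (f : B → Bool) (g : ℕ → List B) (n : ℕ) (h : ℕ → ℕ) →
                         count f (concatMap g (applyUpTo h (suc n))) ≡ Σ≤ n (λ y → count f (g (h y)))
  count-concatMap-upTo f g zero    h = trans (count-++ f (g (h 0)) []) (+-identityʳ _)
  count-concatMap-upTo f g (suc n) h =
    trans (count-++ f (g (h 0)) _) (cong (count f (g (h 0)) +_) (count-concatMap-upTo f g n (h ∘ suc)))

  count-head : ∀ a b (f : List ℕ → Bool) →
               count f (lists (suc a) b) ≡ Σ≤ b (λ x → count (f ∘ (x ∷_)) (lists a b))
  count-head a b f = begin
    count f (lists (suc a) b)                              ≡⟨ count-concatMap-upTo f (λ x → map (x ∷_) (lists a b)) b id ⟩
    Σ≤ b (λ x → count f (map (x ∷_) (lists a b)))          ≡⟨ Σ-cong b (λ x _ → count-map f (x ∷_) (lists a b)) ⟩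
    Σ≤ b (λ x → count (f ∘ (x ∷_)) (lists a b))            ∎
    where open ≡-Reasoning

  count-last : ∀ a b (f : List ℕ → Bool) →
               count f (lists (suc a) b) ≡ Σ≤ b (λ x → count (λ l → f (l ∷ʳ x)) (lists a b))
  count-last zero    b f = count-head zero b f
  count-last (suc a) b f = begin
    count f (lists (suc (suc a)) b)                                          ≡⟨ count-head (suc a) b f ⟩
    Σ≤ b (λ x → count (f ∘ (x ∷_)) (lists (suc a) b))                        ≡⟨ Σ-cong b (λ x _ → count-last a b (f ∘ (x ∷_))) ⟩
    Σ≤ b (λ x → Σ≤ b (λ y → count (λ l → f (x ∷ (l ∷ʳ y))) (lists a b)))     ≡⟨ Σ-swap b b _ ⟩
    Σ≤ b (λ y → Σ≤ b (λ x → count (λ l → f (x ∷ (l ∷ʳ y))) (lists a b)))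
      ≡⟨ Σ-cong b (λ y _ → count-head a b (λ l → f (l ∷ʳ y))) ⟨
    Σ≤ b (λ y → count (λ l → f (l ∷ʳ y)) (lists (suc a) b))                  ∎
    where open ≡-Reasoning

  -- Reversal permutes  lists a b , so it does not change counts.
  count-reverse : ∀ a b (f : List ℕ → Bool) → count f (lists a b) ≡ count (f ∘ reverse) (lists a b)
  count-reverse zero    b f = refl
  count-reverse (suc a) b f = begin
    count f (lists (suc a) b)                                    ≡⟨ count-last a b f ⟩
    Σ≤ b (λ x → count (λ l → f (l ∷ʳ x)) (lists a b))            ≡⟨ Σ-cong b (λ x _ → count-reverse a b (λ l → f (l ∷ʳ x))) ⟩
    Σ≤ b (λ x → count (λ l → f (reverse l ∷ʳ x)) (lists a b))
      ≡⟨ Σ-cong b (λ x _ → count-cong (lists a b) (λ l → cong f (unfold-reverse x l))) ⟨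
    Σ≤ b (λ x → count (λ l → f (reverse (x ∷ l))) (lists a b))   ≡⟨ count-head a b (f ∘ reverse) ⟨
    count (f ∘ reverse) (lists (suc a) b)                        ∎
    where open ≡-Reasoning

  -- Power series in x and q with natural coefficients:  F m n  is the
  -- coefficient of x^m q^n.
  Series : Set
  Series = ℕ → ℕ → ℕ

  infix  4 _≈_
  infixr 6 _⊕_

  _≈_ : Series → Series → Set
  F ≈ G = ∀ m n → F m n ≡ G m n

  𝟘 : Series
  𝟘 _ _ = 0

  _⊕_ : Series → Series → Series
  (F ⊕ G) m n = F m n + G m n

  -- Multiplication by the monomial x^i q^j.
  mono : ℕ → ℕ → Series → Series
  mono i j F m n = if (i ≤ᵇ m) ∧ (j ≤ᵇ n) then F (m ∸ i) (n ∸ j) else 0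

  when : Bool → Series → Series
  when b F = if b then F else 𝟘

  mono-cong : ∀ i j {F G} → F ≈ G → mono i j F ≈ mono i j G
  mono-cong i j F≈G m n = cong (λ c → if (i ≤ᵇ m) ∧ (j ≤ᵇ n) then c else 0) (F≈G (m ∸ i) (n ∸ j))

  mono-𝟘 : ∀ i j → mono i j 𝟘 ≈ 𝟘
  mono-𝟘 i j m n with (i ≤ᵇ m) ∧ (j ≤ᵇ n)
  ... | true  = refl
  ... | false = refl

  mono-⊕ : ∀ i j F G → mono i j (F ⊕ G) ≈ mono i j F ⊕ mono i j G
  mono-⊕ i j F G m n with (i ≤ᵇ m) ∧ (j ≤ᵇ n)
  ... | true  = refl
  ... | false = refl

  mono-mono : ∀ i j i′ j′ F → mono i j (mono i′ j′ F) ≈ mono (i + i′) (j + j′) F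
  mono-mono i j i′ j′ F m n with i ≤? m | j ≤? n
  ... | yes i≤m | yes j≤n rewrite ≤ᵇ-yes i≤m | ≤ᵇ-yes j≤n | ∸-≤ᵇ i i′ m i≤m | ∸-≤ᵇ j j′ n j≤n
                                | ∸-+-assoc m i i′ | ∸-+-assoc n j j′ = refl
  ... | yes i≤m | no  j≰n rewrite ≤ᵇ-yes i≤m | ≤ᵇ-no j≰n | ≤ᵇ-no {j + j′} {n} (λ le → j≰n (m+n≤o⇒m≤o j le)) =
    cong (λ c → if c then F (m ∸ (i + i′)) (n ∸ (j + j′)) else 0) (sym (∧-zeroʳ (i + i′ ≤ᵇ m)))
  ... | no  i≰m | _       rewrite ≤ᵇ-no i≰m | ≤ᵇ-no {i + i′} {m} (λ le → i≰m (m+n≤o⇒m≤o i le)) = refl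

  -- The substitution x ↦ x q^d:  dilate d F (x, q) = F (x q^d, q).
  dilate : ℕ → Series → Series
  dilate d F m n = if m * d ≤ᵇ n then F m (n ∸ m * d) else 0

  if-≤ᵇ-∸ : ∀ a b n (X : ℕ → ℕ) →
    (if a ≤ᵇ n then (if b ≤ᵇ n ∸ a then X (n ∸ a ∸ b) else 0) else 0) ≡ (if a + b ≤ᵇ n then X (n ∸ (a + b)) else 0)
  if-≤ᵇ-∸ a b n X with a ≤? n
  ... | yes a≤n rewrite ≤ᵇ-yes a≤n | ∸-+-assoc n a b | ∸-≤ᵇ a b n a≤n = refl
  ... | no  a≰n rewrite ≤ᵇ-no a≰n | ≤ᵇ-no {a + b} {n} (λ a+b≤n → a≰n (m+n≤o⇒m≤o a a+b≤n)) = refl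

  dilate-cong : ∀ d {F G} → F ≈ G → dilate d F ≈ dilate d G
  dilate-cong d F≈G m n = cong (λ c → if m * d ≤ᵇ n then c else 0) (F≈G m (n ∸ m * d))

  dilate-dilate : ∀ d e F → dilate d (dilate e F) ≈ dilate (d + e) F
  dilate-dilate d e F m n rewrite *-distribˡ-+ m d e = if-≤ᵇ-∸ (m * d) (m * e) n (F m)

  dilate-zero : ∀ F → dilate 0 F ≈ F
  dilate-zero F m n rewrite *-zeroʳ m = refl

  -- Reading the partitions counted by G in increasing order: y may follow x when
  -- x ≤ y, y respects the lower bound s left by the gap condition, and the pair
  -- satisfies the congruence condition.
  Follows : ℕ → ℕ → ℕ → Set
  Follows x s y = x ≤ y × s ≤ y × CongCond y x

  cong? : ∀ y x → Dec (CongCond y x)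
  cong? y x = (y ∸ x ≤? 1) →-dec ((y + x) % 3 ≟ 2)

  follows? : ∀ x s y → Dec (Follows x s y)
  follows? x s y = (x ≤? y) ×-dec (s ≤? y) ×-dec cong? y x

  ContinuesAfter : ℕ → ℕ → List ℕ → Set
  ContinuesAfter x s []      = ⊤
  ContinuesAfter x s (y ∷ μ) = Follows x s y × ContinuesAfter y (3 + x) μ

  continues? : ∀ x s μ → Dec (ContinuesAfter x s μ)
  continues? x s []      = yes tt
  continues? x s (y ∷ μ) = follows? x s y ×-dec continues? y (3 + x) μ

  AscendingFrom : ℕ → List ℕ → Set
  AscendingFrom k []      = ⊤
  AscendingFrom k (x ∷ μ) = k ≤ x × ContinuesAfter x 0 μ

  ascendingFrom? : ∀ k μ → Dec (AscendingFrom k μ)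
  ascendingFrom? k []      = yes tt
  ascendingFrom? k (x ∷ μ) = (k ≤? x) ×-dec continues? x 0 μ

  -- The lower bound the gap condition imposes on a part placed in front of x ∷ r.
  gapBound : List ℕ → ℕ
  gapBound []      = 0
  gapBound (w ∷ _) = 3 + w

  prepend : ∀ y x r → InG (y ∷ x ∷ r) ⇔ (InG (x ∷ r) × Follows x (gapBound r) y)
  prepend y x [] = mk⇔
    (λ { (((le ∷ lk , _ ∷ positive) , _ , cg ∷ lc) , _ ∷ big) → (((lk , positive) , tt , lc) , big) , le , z≤n , cg })
    (λ { ((((lk , positive) , _ , lc) , two≤x ∷ big) , le , _ , cg) →
           ((le ∷ lk , ≤-trans (s≤s z≤n) (≤-trans two≤x le) ∷ positive) , tt , cg ∷ lc) , ≤-trans two≤x le ∷ two≤x ∷ big })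
  prepend y x (w ∷ r) = mk⇔
    (λ { (((le ∷ lk , _ ∷ positive) , (gp , gaps) , cg ∷ lc) , _ ∷ big) → (((lk , positive) , gaps , lc) , big) , le , gp , cg })
    (λ { ((((lk , positive) , gaps , lc) , two≤x ∷ big) , le , gp , cg) →
           ((le ∷ lk , ≤-trans (s≤s z≤n) (≤-trans two≤x le) ∷ positive) , (gp , gaps) , cg ∷ lc) , ≤-trans two≤x le ∷ two≤x ∷ big })

  reverseOnto : ∀ μ x r → InG (reverseAcc (x ∷ r) μ) ⇔ (InG (x ∷ r) × ContinuesAfter x (gapBound r) μ)
  reverseOnto []      x r = mk⇔ (_, tt) proj₁
  reverseOnto (y ∷ μ) x r = mk⇔
    (λ p → let (q , c) = to ih p ; (q′ , f) = to (prepend y x r) q in q′ , f , c)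
    (λ (q′ , f , c) → from ih (from (prepend y x r) (q′ , f) , c))
    where
    open Equivalence
    ih = reverseOnto μ y (x ∷ r)

  inG-reverse : ∀ μ → InG (reverse μ) ⇔ AscendingFrom 2 μ
  inG-reverse []      = mk⇔ (λ _ → tt) (λ _ → (([] , []) , tt , []) , [])
  inG-reverse (x ∷ μ) = mk⇔
    (λ p → case to (reverseOnto μ x []) p of λ { ((_ , two≤x ∷ []) , c) → two≤x , c })
    (λ (two≤x , c) → from (reverseOnto μ x [])
       (((([-] , ≤-trans (s≤s z≤n) two≤x ∷ []) , tt , [-]) , two≤x ∷ []) , c))
    where open Equivalence

  follows : ℕ → ℕ → ℕ → Bool
  follows x s y = does (follows? x s y)

  Cont : ℕ → ℕ → Series
  Cont x s zero    r = if 0 ≡ᵇ r then 1 else 0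
  Cont x s (suc m) r = Σ≤ r (λ y → if (y ≤ᵇ r) ∧ follows x s y then Cont y (3 + x) m (r ∸ y) else 0)

  Asc : ℕ → Series
  Asc k zero    n = if 0 ≡ᵇ n then 1 else 0
  Asc k (suc m) n = Σ≤ n (λ y → if (y ≤ᵇ n) ∧ (k ≤ᵇ y) then Cont y 0 m (n ∸ y) else 0)

  count-by-head : ∀ a b r (P : List ℕ → Bool) → r ≤ b →
    count (λ μ → (sum μ ≡ᵇ r) ∧ P μ) (lists (suc a) b)
      ≡ Σ≤ r (λ y → if y ≤ᵇ r then count (λ l → (sum l ≡ᵇ r ∸ y) ∧ P (y ∷ l)) (lists a b) else 0)
  count-by-head a b r P r≤b = begin
    count (λ μ → (sum μ ≡ᵇ r) ∧ P μ) (lists (suc a) b)                      ≡⟨ count-head a b _ ⟩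
    Σ≤ b (λ y → count (λ l → (y + sum l ≡ᵇ r) ∧ P (y ∷ l)) (lists a b))    ≡⟨ Σ-cong b (λ y _ → by-first y) ⟩
    Σ≤ b F                                                                  ≡⟨ Σ-truncate r b r≤b beyond ⟩
    Σ≤ r F                                                                  ∎
    where
    open ≡-Reasoning
    F : ℕ → ℕ
    F y = if y ≤ᵇ r then count (λ l → (sum l ≡ᵇ r ∸ y) ∧ P (y ∷ l)) (lists a b) else 0
    by-first : ∀ y → count (λ l → (y + sum l ≡ᵇ r) ∧ P (y ∷ l)) (lists a b) ≡ F y
    by-first y with y ≤? r
    ... | yes y≤r rewrite ≤ᵇ-yes y≤r = count-cong (lists a b) (λ l → cong (_∧ P (y ∷ l)) (+≡ᵇ-∸ y r (sum l) y≤r))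
    ... | no  y≰r rewrite ≤ᵇ-no y≰r  = count-none (lists a b) (λ l → cong (_∧ P (y ∷ l)) (+≡ᵇ-over y r (sum l) (≰⇒> y≰r)))
    beyond : ∀ y → r < y → F y ≡ 0
    beyond y r<y rewrite ≤ᵇ-no (<⇒≱ r<y) = refl

  base-count : ∀ r → (if (0 ≡ᵇ r) ∧ true then 1 else 0) + 0 ≡ (if 0 ≡ᵇ r then 1 else 0)
  base-count zero    = refl
  base-count (suc r) = refl

  count-continues : ∀ a b x s r → r ≤ b →
    count (λ μ → (sum μ ≡ᵇ r) ∧ does (continues? x s μ)) (lists a b) ≡ Cont x s a r
  count-continues zero    b x s r _   = base-count r
  count-continues (suc a) b x s r r≤b = trans (count-by-head a b r (does ∘ continues? x s) r≤b) (Σ-cong r next)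
    where
    next : ∀ y → y ≤ r →
      (if y ≤ᵇ r then count (λ l → (sum l ≡ᵇ r ∸ y) ∧ (follows x s y ∧ does (continues? y (3 + x) l))) (lists a b) else 0)
        ≡ (if (y ≤ᵇ r) ∧ follows x s y then Cont y (3 + x) a (r ∸ y) else 0)
    next y y≤r rewrite ≤ᵇ-yes y≤r =
      trans (count-guard (λ l → sum l ≡ᵇ r ∸ y) (does ∘ continues? y (3 + x)) (follows x s y) (lists a b))
            (cong (λ c → if follows x s y then c else 0) (count-continues a b y (3 + x) (r ∸ y) (≤-trans (m∸n≤m r y) r≤b)))

  count-ascending : ∀ k a b n → n ≤ b →
    count (λ μ → (sum μ ≡ᵇ n) ∧ does (ascendingFrom? k μ)) (lists a b) ≡ Asc k a n
  count-ascending k zero    b n _   = base-count n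
  count-ascending k (suc a) b n n≤b = trans (count-by-head a b n (does ∘ ascendingFrom? k) n≤b) (Σ-cong n first)
    where
    first : ∀ y → y ≤ n →
      (if y ≤ᵇ n then count (λ l → (sum l ≡ᵇ n ∸ y) ∧ ((k ≤ᵇ y) ∧ does (continues? y 0 l))) (lists a b) else 0)
        ≡ (if (y ≤ᵇ n) ∧ (k ≤ᵇ y) then Cont y 0 a (n ∸ y) else 0)
    first y y≤n rewrite ≤ᵇ-yes y≤n =
      trans (count-guard (λ l → sum l ≡ᵇ n ∸ y) (does ∘ continues? y 0) (k ≤ᵇ y) (lists a b))
            (cong (λ c → if k ≤ᵇ y then c else 0) (count-continues a b y 0 (n ∸ y) (≤-trans (m∸n≤m n y) n≤b)))

  gCoef≡Asc : ∀ a b → gCoef a b ≡ Asc 2 a b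
  gCoef≡Asc a b = begin
    gCoef a b                                                                      ≡⟨ count-filter (λ ls → (sum ls ≟ b) ×-dec inG? ls) (lists a b) ⟩
    count (λ ls → (sum ls ≡ᵇ b) ∧ does (inG? ls)) (lists a b)                      ≡⟨ count-reverse a b (λ ls → (sum ls ≡ᵇ b) ∧ does (inG? ls)) ⟩
    count (λ ls → (sum (reverse ls) ≡ᵇ b) ∧ does (inG? (reverse ls))) (lists a b)  ≡⟨ count-cong (lists a b) read-increasing ⟩
    count (λ ls → (sum ls ≡ᵇ b) ∧ does (ascendingFrom? 2 ls)) (lists a b)          ≡⟨ count-ascending 2 a b b ≤-refl ⟩
    Asc 2 a b                                                                      ∎
    where
    open ≡-Reasoning
    read-increasing : ∀ ls → ((sum (reverse ls) ≡ᵇ b) ∧ does (inG? (reverse ls))) ≡ ((sum ls ≡ᵇ b) ∧ does (ascendingFrom? 2 ls))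
    read-increasing ls = cong₂ (λ u v → (u ≡ᵇ b) ∧ v) (sum-↭ (↭-reverse ls))
                               (does-⇔ (inG-reverse ls) (inG? (reverse ls)) (ascendingFrom? 2 ls))

  congᵇ : ℕ → ℕ → Bool
  congᵇ y x = does (cong? y x)

  congᵇ-far : ∀ d x → congᵇ (2 + d + x) x ≡ true
  congᵇ-far d x rewrite m+n∸n≡m (2 + d) x = refl

  congᵇ-self : ∀ k {ρ} → k % 3 ≡ ρ → congᵇ k k ≡ (ρ ≡ᵇ 1)
  congᵇ-self k refl = begin
    congᵇ k k                         ≡⟨ cong (λ t → not (t ≤ᵇ 1) ∨ ((k + k) % 3 ≡ᵇ 2)) (n∸n≡0 k) ⟩
    ((k + k) % 3 ≡ᵇ 2)                ≡⟨ cong (_≡ᵇ 2) (%-distribˡ-+ k k 3) ⟩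
    ((k % 3 + k % 3) % 3 ≡ᵇ 2)        ≡⟨ table (k % 3) (m%n<n k 3) ⟩
    (k % 3 ≡ᵇ 1)                      ∎
    where
    open ≡-Reasoning
    table : ∀ ρ → ρ < 3 → ((ρ + ρ) % 3 ≡ᵇ 2) ≡ (ρ ≡ᵇ 1)
    table 0 _ = refl
    table 1 _ = refl
    table 2 _ = refl
    table (suc (suc (suc _))) (s≤s (s≤s (s≤s ())))

  congᵇ-succ : ∀ k {ρ} → k % 3 ≡ ρ → congᵇ (suc k) k ≡ (ρ ≡ᵇ 2)
  congᵇ-succ k refl = begin
    congᵇ (suc k) k                        ≡⟨ cong (λ t → not (t ≤ᵇ 1) ∨ ((1 + (k + k)) % 3 ≡ᵇ 2)) (m+n∸n≡m 1 k) ⟩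
    ((1 + (k + k)) % 3 ≡ᵇ 2)               ≡⟨ cong (_≡ᵇ 2) (%-distribˡ-+ 1 (k + k) 3) ⟩
    ((1 + (k + k) % 3) % 3 ≡ᵇ 2)           ≡⟨ cong (λ t → (1 + t) % 3 ≡ᵇ 2) (%-distribˡ-+ k k 3) ⟩
    ((1 + (k % 3 + k % 3) % 3) % 3 ≡ᵇ 2)   ≡⟨ table (k % 3) (m%n<n k 3) ⟩
    (k % 3 ≡ᵇ 2)                           ∎
    where
    open ≡-Reasoning
    table : ∀ ρ → ρ < 3 → ((1 + (ρ + ρ) % 3) % 3 ≡ᵇ 2) ≡ (ρ ≡ᵇ 2)
    table 0 _ = refl
    table 1 _ = refl
    table 2 _ = refl
    table (suc (suc (suc _))) (s≤s (s≤s (s≤s ())))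

  residue : ∀ i k {ρ} → k % 3 ≡ ρ → (i + k) % 3 ≡ (i + ρ) % 3
  residue i k refl = begin
    (i + k) % 3                 ≡⟨ %-distribˡ-+ i k 3 ⟩
    (i % 3 + k % 3) % 3         ≡⟨ cong (λ t → (i % 3 + t) % 3) (m%n%n≡m%n k 3) ⟨
    (i % 3 + k % 3 % 3) % 3     ≡⟨ %-distribˡ-+ i (k % 3) 3 ⟨
    (i + k % 3) % 3             ∎
    where open ≡-Reasoning

  congᵇ-3+ : ∀ y x → congᵇ (3 + y) (3 + x) ≡ congᵇ y x
  congᵇ-3+ y x = cong (λ t → not (y ∸ x ≤ᵇ 1) ∨ (t ≡ᵇ 2)) (trans (cong (_% 3) (regroup y x)) ([m+kn]%n≡m%n (y + x) 2 3))
    where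
    regroup : ∀ y x → 3 + y + (3 + x) ≡ y + x + 2 * 3
    regroup = solve-∀

  split : ∀ k → Asc k ≈ Asc (suc k) ⊕ mono 1 k (Cont k 0)
  split k zero    n = sym (+-identityʳ _)
  split k (suc m) n = begin
    Σ≤ n (λ y → if (y ≤ᵇ n) ∧ (k ≤ᵇ y) then F y else 0)                         ≡⟨ Σ-cong n exactly-k ⟩
    Σ≤ n (λ y → (if (y ≤ᵇ n) ∧ (suc k ≤ᵇ y) then F y else 0) + (if y ≡ᵇ k then F y else 0))
                                                                                ≡⟨ Σ-+ n _ _ ⟩
    Asc (suc k) (suc m) n + Σ≤ n (λ y → if y ≡ᵇ k then F y else 0)             ≡⟨ cong (Asc (suc k) (suc m) n +_) (Σ-single n k F) ⟩
    Asc (suc k) (suc m) n + mono 1 k (Cont k 0) (suc m) n                       ∎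
    where
    open ≡-Reasoning
    F : ℕ → ℕ
    F y = Cont y 0 m (n ∸ y)
    exactly-k : ∀ y → y ≤ n → (if (y ≤ᵇ n) ∧ (k ≤ᵇ y) then F y else 0)
                              ≡ (if (y ≤ᵇ n) ∧ (suc k ≤ᵇ y) then F y else 0) + (if y ≡ᵇ k then F y else 0)
    exactly-k y y≤n rewrite ≤ᵇ-yes y≤n with <-cmp k y
    ... | tri< k<y _ _ rewrite ≤ᵇ-yes (<⇒≤ k<y) | ≤ᵇ-yes k<y | ≡ᵇ-no (≢-sym (<⇒≢ k<y)) = sym (+-identityʳ _)
    ... | tri≈ _ refl _ rewrite ≤ᵇ-yes (≤-refl {k}) | ≤ᵇ-no (n≮n k) | ≡ᵇ-yes k = refl
    ... | tri> _ _ y<k rewrite ≤ᵇ-no (<⇒≱ y<k) | ≤ᵇ-no (<⇒≱ (m<n⇒m<1+n y<k)) | ≡ᵇ-no (<⇒≢ y<k) = refl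

  bound-irrelevant : ∀ x s → (∀ d → d + x < s → congᵇ (d + x) x ≡ false) → Cont x s ≈ Cont x 0
  bound-irrelevant x s excluded zero    r = refl
  bound-irrelevant x s excluded (suc m) r =
    Σ-cong r (λ y _ → cong (λ c → if (y ≤ᵇ r) ∧ c then Cont y (3 + x) m (r ∸ y) else 0) (same-test y))
    where
    same-test : ∀ y → follows x s y ≡ follows x 0 y
    same-test y with x ≤? y
    ... | no  x≰y rewrite ≤ᵇ-no x≰y = refl
    ... | yes x≤y rewrite ≤ᵇ-yes x≤y with s ≤? y
    ...   | yes s≤y rewrite ≤ᵇ-yes s≤y = refl
    ...   | no  s≰y rewrite ≤ᵇ-no s≰y =
      sym (subst (λ z → congᵇ z x ≡ false) (m∸n+n≡m x≤y)
                 (excluded (y ∸ x) (subst (_< s) (sym (m∸n+n≡m x≤y)) (≰⇒> s≰y))))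

  bound-below : ∀ x s → s ≤ x → Cont x s ≈ Cont x 0
  bound-below x s s≤x = bound-irrelevant x s (λ d lt → ⊥-elim (m+n≮n d x (<-≤-trans lt s≤x)))

  bound-one : ∀ x → congᵇ x x ≡ false → Cont x (suc x) ≈ Cont x 0
  bound-one x not-self = bound-irrelevant x (suc x) excluded
    where
    excluded : ∀ d → d + x < suc x → congᵇ (d + x) x ≡ false
    excluded zero    _  = not-self
    excluded (suc d) lt = ⊥-elim (m+n≮n d x (≤-pred lt))

  bound-two : ∀ x → congᵇ x x ≡ false → congᵇ (suc x) x ≡ false → Cont x (2 + x) ≈ Cont x 0
  bound-two x not-self not-succ = bound-irrelevant x (2 + x) excluded
    where
    excluded : ∀ d → d + x < 2 + x → congᵇ (d + x) x ≡ false
    excluded zero          _  = not-self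
    excluded (suc zero)    _  = not-succ
    excluded (suc (suc d)) lt = ⊥-elim (m+n≮n d x (≤-pred (≤-pred lt)))

  admissible : ℕ → ℕ → ℕ → Bool
  admissible s x y = (s ≤ᵇ y) ∧ congᵇ y x

  nextPart : ℕ → ℕ → ℕ → Series
  nextPart s x d = when (admissible s x (d + x)) (mono 1 (d + x) (Cont (d + x) (3 + x)))

  exactlyNext : ℕ → ℕ → ℕ → ℕ → ℕ → ℕ → ℕ
  exactlyNext s x m r d y = if y ≡ᵇ d + x then (if admissible s x (d + x) then Cont y (3 + x) m (r ∸ y) else 0) else 0

  farNext : ℕ → ℕ → ℕ → ℕ → ℕ
  farNext x m r y = if (y ≤ᵇ r) ∧ (3 + x ≤ᵇ y) then Cont y 0 m (r ∸ y) else 0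

  Σ-exactlyNext : ∀ s x m r d → Σ≤ r (exactlyNext s x m r d) ≡ nextPart s x d (suc m) r
  Σ-exactlyNext s x m r d with Σ-single r (d + x) (λ y → if admissible s x (d + x) then Cont y (3 + x) m (r ∸ y) else 0)
  ... | single with admissible s x (d + x)
  ...   | true  = single
  ...   | false with d + x ≤ᵇ r
  ...     | true  = single
  ...     | false = single

  below-offset : ∀ {x y} → ¬ x ≤ y → ∀ d → y ≢ d + x
  below-offset {x} x≰y d refl = x≰y (m≤n+m x d)

  -- The next part y after x is x, x + 1, x + 2 (subject to the congruence condition
  -- and the bound s) or at least x + 3, in which case every condition involving x is
  -- automatic and y starts an arbitrary admissible sequence with parts ≥ x + 3.
  next-part-cases : ∀ x s → s ≤ 3 + x → ∀ m r y → y ≤ r →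
    (if (y ≤ᵇ r) ∧ follows x s y then Cont y (3 + x) m (r ∸ y) else 0)
      ≡ exactlyNext s x m r 0 y + (exactlyNext s x m r 1 y + (exactlyNext s x m r 2 y + farNext x m r y))
  next-part-cases x s s≤3+x m r y y≤r with x ≤? y
  ... | yes x≤y = subst (λ z → (if (z ≤ᵇ r) ∧ follows x s z then Cont z (3 + x) m (r ∸ z) else 0)
                                 ≡ exactlyNext s x m r 0 z + (exactlyNext s x m r 1 z + (exactlyNext s x m r 2 z + farNext x m r z)))
                        (m∸n+n≡m x≤y) (at-offset (y ∸ x) (subst (_≤ r) (sym (m∸n+n≡m x≤y)) y≤r))
    where
    by-offset : ∀ d →
      (if admissible s x (d + x) then Cont (d + x) (3 + x) m (r ∸ (d + x)) else 0)
        ≡ (if d ≡ᵇ 0 then (if admissible s x x then Cont (d + x) (3 + x) m (r ∸ (d + x)) else 0) else 0)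
          + ((if d ≡ᵇ 1 then (if admissible s x (1 + x) then Cont (d + x) (3 + x) m (r ∸ (d + x)) else 0) else 0)
          + ((if d ≡ᵇ 2 then (if admissible s x (2 + x) then Cont (d + x) (3 + x) m (r ∸ (d + x)) else 0) else 0)
          + (if 3 ≤ᵇ d then Cont (d + x) 0 m (r ∸ (d + x)) else 0)))
    by-offset 0 = sym (+-identityʳ _)
    by-offset 1 = sym (+-identityʳ _)
    by-offset 2 = sym (+-identityʳ _)
    by-offset (suc (suc (suc e)))
      rewrite ≤ᵇ-yes (≤-trans s≤3+x (+-monoˡ-≤ x (m≤m+n 3 e))) | congᵇ-far (suc e) x =
        bound-below (3 + e + x) (3 + x) (+-monoˡ-≤ x (m≤m+n 3 e)) m (r ∸ (3 + e + x))
    at-offset : ∀ d → d + x ≤ r →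
      (if (d + x ≤ᵇ r) ∧ follows x s (d + x) then Cont (d + x) (3 + x) m (r ∸ (d + x)) else 0)
        ≡ exactlyNext s x m r 0 (d + x) + (exactlyNext s x m r 1 (d + x) + (exactlyNext s x m r 2 (d + x) + farNext x m r (d + x)))
    at-offset d d+x≤r
      rewrite ≤ᵇ-yes d+x≤r | ≤ᵇ-yes (m≤n+m x d) | +ʳ-≡ᵇ d 0 x | +ʳ-≡ᵇ d 1 x | +ʳ-≡ᵇ d 2 x | +ʳ-≤ᵇ 3 d x
      = by-offset d
  ... | no  x≰y
    rewrite ≤ᵇ-yes y≤r | ≤ᵇ-no x≰y | ≡ᵇ-no (below-offset x≰y 0) | ≡ᵇ-no (below-offset x≰y 1) | ≡ᵇ-no (below-offset x≰y 2)
          | ≤ᵇ-no (λ (le : 3 + x ≤ y) → x≰y (≤-trans (m≤n+m x 3) le)) = refl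

  nextPart-no-parts : ∀ s x d r → nextPart s x d 0 r ≡ 0
  nextPart-no-parts s x d r with admissible s x (d + x)
  ... | true  = refl
  ... | false = refl

  expand : ∀ x s → s ≤ 3 + x → Cont x s ≈ nextPart s x 0 ⊕ nextPart s x 1 ⊕ nextPart s x 2 ⊕ Asc (3 + x)
  expand x s s≤3+x zero r
    rewrite nextPart-no-parts s x 0 r | nextPart-no-parts s x 1 r | nextPart-no-parts s x 2 r = refl
  expand x s s≤3+x (suc m) r = begin
    Σ≤ r (λ y → if (y ≤ᵇ r) ∧ follows x s y then Cont y (3 + x) m (r ∸ y) else 0)
      ≡⟨ Σ-cong r (next-part-cases x s s≤3+x m r) ⟩
    Σ≤ r (λ y → Exactly 0 y + (Exactly 1 y + (Exactly 2 y + farNext x m r y)))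
      ≡⟨ Σ-+ r (Exactly 0) _ ⟩
    Σ≤ r (Exactly 0) + Σ≤ r (λ y → Exactly 1 y + (Exactly 2 y + farNext x m r y))
      ≡⟨ cong (Σ≤ r (Exactly 0) +_) (Σ-+ r (Exactly 1) _) ⟩
    Σ≤ r (Exactly 0) + (Σ≤ r (Exactly 1) + Σ≤ r (λ y → Exactly 2 y + farNext x m r y))
      ≡⟨ cong (λ t → Σ≤ r (Exactly 0) + (Σ≤ r (Exactly 1) + t)) (Σ-+ r (Exactly 2) (farNext x m r)) ⟩
    Σ≤ r (Exactly 0) + (Σ≤ r (Exactly 1) + (Σ≤ r (Exactly 2) + Asc (3 + x) (suc m) r))
      ≡⟨ cong₂ _+_ (Σ-exactlyNext s x m r 0) (cong₂ _+_ (Σ-exactlyNext s x m r 1) (cong (_+ Asc (3 + x) (suc m) r) (Σ-exactlyNext s x m r 2))) ⟩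
    nextPart s x 0 (suc m) r + (nextPart s x 1 (suc m) r + (nextPart s x 2 (suc m) r + Asc (3 + x) (suc m) r))
      ∎
    where
    open ≡-Reasoning
    Exactly : ℕ → ℕ → ℕ
    Exactly = exactlyNext s x m r

  nextPart-closed : ∀ s x d → admissible s x (d + x) ≡ false → nextPart s x d ≈ 𝟘
  nextPart-closed s x d closed m n rewrite closed = refl

  nextPart-open : ∀ s x d → admissible s x (d + x) ≡ true → nextPart s x d ≈ mono 1 (d + x) (Cont (d + x) (3 + x))
  nextPart-open s x d open′ m n rewrite open′ = refl

  -- A part z that cannot be repeated: bounding the next part by z + 1 changes nothing,
  -- so the sequences starting with z and those starting above z give all starting at ≥ z.
  fold : ∀ z → congᵇ z z ≡ false → mono 1 z (Cont z (suc z)) ⊕ Asc (suc z) ≈ Asc z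
  fold z not-self m n = begin
    mono 1 z (Cont z (suc z)) m n + Asc (suc z) m n ≡⟨ cong (_+ Asc (suc z) m n) (mono-cong 1 z (bound-one z not-self) m n) ⟩
    mono 1 z (Cont z 0) m n + Asc (suc z) m n       ≡⟨ +-comm (mono 1 z (Cont z 0) m n) _ ⟩
    Asc (suc z) m n + mono 1 z (Cont z 0) m n       ≡⟨ split z m n ⟨
    Asc z m n                                       ∎
    where open ≡-Reasoning

  -- After x with next part ≥ x + 3 nothing involving x constrains the rest.
  blocked : ∀ x → Cont x (3 + x) ≈ Asc (3 + x)
  blocked x m n = begin
    Cont x (3 + x) m n
      ≡⟨ expand x (3 + x) ≤-refl m n ⟩
    nextPart (3 + x) x 0 m n + (nextPart (3 + x) x 1 m n + (nextPart (3 + x) x 2 m n + Asc (3 + x) m n))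
      ≡⟨ cong₂ _+_ (too-small 0 (s≤s z≤n)) (cong₂ _+_ (too-small 1 (s≤s (s≤s z≤n))) (cong (_+ Asc (3 + x) m n) (too-small 2 ≤-refl))) ⟩
    Asc (3 + x) m n
      ∎
    where
    open ≡-Reasoning
    too-small : ∀ d → d < 3 → nextPart (3 + x) x d m n ≡ 0
    too-small d d<3 = nextPart-closed (3 + x) x d (cong (_∧ congᵇ (d + x) x) (≤ᵇ-no (λ le → <⇒≱ d<3 (+-cancelʳ-≤ x 3 d le)))) m n

  -- Continuations of a part k ≡ 0 (mod 3): the next part must be k + 2.
  cont₀ : ∀ k → k % 3 ≡ 0 → Cont k 0 ≈ Asc (2 + k)
  cont₀ k k≡0 m n = begin
    Cont k 0 m n
      ≡⟨ expand k 0 z≤n m n ⟩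
    nextPart 0 k 0 m n + (nextPart 0 k 1 m n + (nextPart 0 k 2 m n + Asc (3 + k) m n))
      ≡⟨ cong₂ _+_ (nextPart-closed 0 k 0 (congᵇ-self k k≡0) m n)
          (cong₂ _+_ (nextPart-closed 0 k 1 (congᵇ-succ k k≡0) m n)
                     (cong (_+ Asc (3 + k) m n) (nextPart-open 0 k 2 (congᵇ-far 0 k) m n))) ⟩
    mono 1 (2 + k) (Cont (2 + k) (3 + k)) m n + Asc (3 + k) m n
      ≡⟨ fold (2 + k) (congᵇ-self (2 + k) (residue 2 k k≡0)) m n ⟩
    Asc (2 + k) m n
      ∎
    where open ≡-Reasoning

  -- Continuations of a part y ≡ 1 (mod 3) that may not be repeated: the next part must be y + 2.
  cont₁-unrepeated : ∀ y → y % 3 ≡ 1 → Cont y (suc y) ≈ Asc (2 + y)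
  cont₁-unrepeated y y≡1 m n = begin
    Cont y (suc y) m n
      ≡⟨ expand y (suc y) (m≤n+m (suc y) 2) m n ⟩
    nextPart (suc y) y 0 m n + (nextPart (suc y) y 1 m n + (nextPart (suc y) y 2 m n + Asc (3 + y) m n))
      ≡⟨ cong₂ _+_ (nextPart-closed (suc y) y 0 (cong (_∧ congᵇ y y) (≤ᵇ-no (n≮n y))) m n)
          (cong₂ _+_ (nextPart-closed (suc y) y 1 (cong₂ _∧_ (≤ᵇ-yes (≤-refl {suc y})) (congᵇ-succ y y≡1)) m n)
                     (cong (_+ Asc (3 + y) m n) (nextPart-open (suc y) y 2 (cong₂ _∧_ (≤ᵇ-yes (n≤1+n (suc y))) (congᵇ-far 0 y)) m n))) ⟩
    mono 1 (2 + y) (Cont (2 + y) (3 + y)) m n + Asc (3 + y) m n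
      ≡⟨ fold (2 + y) (congᵇ-self (2 + y) (residue 2 y y≡1)) m n ⟩
    Asc (2 + y) m n
      ∎
    where open ≡-Reasoning

  -- Continuations of a part k ≡ 1 (mod 3): either k is repeated (and then the next
  -- part is at least k + 3), or the next part is k + 2.
  cont₁ : ∀ k → k % 3 ≡ 1 → Cont k 0 ≈ mono 1 k (Asc (3 + k)) ⊕ Asc (2 + k)
  cont₁ k k≡1 m n = begin
    Cont k 0 m n
      ≡⟨ expand k 0 z≤n m n ⟩
    nextPart 0 k 0 m n + (nextPart 0 k 1 m n + (nextPart 0 k 2 m n + Asc (3 + k) m n))
      ≡⟨ cong₂ _+_ (nextPart-open 0 k 0 (congᵇ-self k k≡1) m n)
          (cong₂ _+_ (nextPart-closed 0 k 1 (congᵇ-succ k k≡1) m n)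
                     (cong (_+ Asc (3 + k) m n) (nextPart-open 0 k 2 (congᵇ-far 0 k) m n))) ⟩
    mono 1 k (Cont k (3 + k)) m n + (mono 1 (2 + k) (Cont (2 + k) (3 + k)) m n + Asc (3 + k) m n)
      ≡⟨ cong₂ _+_ (mono-cong 1 k (blocked k) m n) (fold (2 + k) (congᵇ-self (2 + k) (residue 2 k k≡1)) m n) ⟩
    mono 1 k (Asc (3 + k)) m n + Asc (2 + k) m n
      ∎
    where open ≡-Reasoning

  -- Continuations of a part k ≡ 2 (mod 3): the next part is k + 1 (after which the
  -- following one is at least k + 3) or k + 2 (which may then not be repeated), or
  -- it is at least k + 3.
  cont₂ : ∀ k → k % 3 ≡ 2 → Cont k 0 ≈ mono 1 (1 + k) (Asc (3 + k)) ⊕ mono 1 (2 + k) (Asc (4 + k)) ⊕ Asc (3 + k)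
  cont₂ k k≡2 m n = begin
    Cont k 0 m n
      ≡⟨ expand k 0 z≤n m n ⟩
    nextPart 0 k 0 m n + (nextPart 0 k 1 m n + (nextPart 0 k 2 m n + Asc (3 + k) m n))
      ≡⟨ cong₂ _+_ (nextPart-closed 0 k 0 (congᵇ-self k k≡2) m n)
          (cong₂ _+_ (nextPart-open 0 k 1 (congᵇ-succ k k≡2) m n)
                     (cong (_+ Asc (3 + k) m n) (nextPart-open 0 k 2 (congᵇ-far 0 k) m n))) ⟩
    mono 1 (1 + k) (Cont (1 + k) (3 + k)) m n + (mono 1 (2 + k) (Cont (2 + k) (3 + k)) m n + Asc (3 + k) m n)
      ≡⟨ cong₂ _+_ (mono-cong 1 (1 + k) after-succ m n)
                   (cong (_+ Asc (3 + k) m n) (mono-cong 1 (2 + k) (cont₁-unrepeated (2 + k) (residue 2 k k≡2)) m n)) ⟩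
    mono 1 (1 + k) (Asc (3 + k)) m n + (mono 1 (2 + k) (Asc (4 + k)) m n + Asc (3 + k) m n)
      ∎
    where
    open ≡-Reasoning
    k+1≡0 : (1 + k) % 3 ≡ 0
    k+1≡0 = residue 1 k k≡2
    after-succ : Cont (1 + k) (3 + k) ≈ Asc (3 + k)
    after-succ m n = trans (bound-two (1 + k) (congᵇ-self (1 + k) k+1≡0) (congᵇ-succ (1 + k) k+1≡0) m n) (cont₀ (1 + k) k+1≡0 m n)

  follows-3+ : ∀ x s y → follows (3 + x) (3 + s) (3 + y) ≡ follows x s y
  follows-3+ x s y rewrite ≤ᵇ-3+ x y | ≤ᵇ-3+ s y | congᵇ-3+ y x = refl

  -- Subtracting 3 from every part: continuations after x + 3 are those after x with x ↦ x q³.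
  Cont-shift : ∀ x s → Cont (3 + x) (3 + s) ≈ dilate 3 (Cont x s)
  Cont-shift x s zero    r                   = refl
  Cont-shift x s (suc m) 0                   = refl
  Cont-shift x s (suc m) 1                   = refl
  Cont-shift x s (suc m) 2                   = refl
  Cont-shift x s (suc m) (suc (suc (suc r))) rewrite ≤ᵇ-3+ (m * 3) r =
    trans (Σ-cong r shifted) (Σ-delay r (m * 3) (follows x s) (λ y → Cont y (3 + x) m))
    where
    shifted : ∀ y → y ≤ r →
      (if (3 + y ≤ᵇ 3 + r) ∧ follows (3 + x) (3 + s) (3 + y) then Cont (3 + y) (3 + (3 + x)) m (r ∸ y) else 0)
        ≡ (if (y ≤ᵇ r) ∧ follows x s y then dilate 3 (Cont y (3 + x)) m (r ∸ y) else 0)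
    shifted y _ rewrite ≤ᵇ-3+ y r | follows-3+ x s y | Cont-shift y (3 + x) m (r ∸ y) = refl

  Asc-shift : ∀ k → Asc (3 + k) ≈ dilate 3 (Asc k)
  Asc-shift k zero    r                   = refl
  Asc-shift k (suc m) 0                   = refl
  Asc-shift k (suc m) 1                   = refl
  Asc-shift k (suc m) 2                   = refl
  Asc-shift k (suc m) (suc (suc (suc r))) rewrite ≤ᵇ-3+ (m * 3) r =
    trans (Σ-cong r shifted) (Σ-delay r (m * 3) (k ≤ᵇ_) (λ y → Cont y 0 m))
    where
    shifted : ∀ y → y ≤ r →
      (if (3 + y ≤ᵇ 3 + r) ∧ (3 + k ≤ᵇ 3 + y) then Cont (3 + y) 0 m (r ∸ y) else 0)
        ≡ (if (y ≤ᵇ r) ∧ (k ≤ᵇ y) then dilate 3 (Cont y 0) m (r ∸ y) else 0)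
    shifted y _ rewrite ≤ᵇ-3+ y r | ≤ᵇ-3+ k y
                      | sym (bound-below (3 + y) 3 (m≤m+n 3 y) m (r ∸ y)) | Cont-shift y 0 m (r ∸ y) = refl

  Asc-dilated : ∀ t → Asc (t * 3 + 2) ≈ dilate (t * 3) (Asc 2)
  Asc-dilated zero    m n = sym (dilate-zero (Asc 2) m n)
  Asc-dilated (suc t) m n = begin
    Asc (3 + (t * 3 + 2)) m n                ≡⟨ Asc-shift (t * 3 + 2) m n ⟩
    dilate 3 (Asc (t * 3 + 2)) m n           ≡⟨ dilate-cong 3 (Asc-dilated t) m n ⟩
    dilate 3 (dilate (t * 3) (Asc 2)) m n    ≡⟨ dilate-dilate 3 (t * 3) (Asc 2) m n ⟩
    dilate (3 + t * 3) (Asc 2) m n           ∎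
    where open ≡-Reasoning

  module LinearRelations (A : ℕ → Series) where

    -- (i , j , k) stands for  x^i q^j A k.
    Atom : Set
    Atom = ℕ × ℕ × ℕ

    atom : Atom → Series
    atom (i , j , k) = mono i j (A k)

    Σatoms : List Atom → Series
    Σatoms []      = 𝟘
    Σatoms (α ∷ R) = atom α ⊕ Σatoms R

    shiftAtoms : ℕ → ℕ → List Atom → List Atom
    shiftAtoms i j = map (λ (i′ , j′ , k) → (i + i′ , j + j′ , k))

    mono-Σatoms : ∀ i j R → mono i j (Σatoms R) ≈ Σatoms (shiftAtoms i j R)
    mono-Σatoms i j []                  m n = mono-𝟘 i j m n
    mono-Σatoms i j ((i′ , j′ , k) ∷ R) m n =
      trans (mono-⊕ i j (atom (i′ , j′ , k)) (Σatoms R) m n)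
            (cong₂ _+_ (mono-mono i j i′ j′ (A k) m n) (mono-Σatoms i j R m n))

    Term : Set
    Term = ℤ × Atom

    value : Term → ℕ → ℕ → ℤ
    value (c , α) a b = c *ℤ pos (atom α a b)

    ⟦_⟧ : List Term → ℕ → ℕ → ℤ
    ⟦ [] ⟧    a b = 0ℤ
    ⟦ t ∷ L ⟧ a b = value t a b +ℤ ⟦ L ⟧ a b

    ⟦++⟧ : ∀ L L′ a b → ⟦ L ++ L′ ⟧ a b ≡ ⟦ L ⟧ a b +ℤ ⟦ L′ ⟧ a b
    ⟦++⟧ []            L′ a b = sym (ℤP.+-identityˡ _)
    ⟦++⟧ ((c , α) ∷ L) L′ a b = trans (cong (value (c , α) a b +ℤ_) (⟦++⟧ L L′ a b))
                                      (sym (ℤP.+-assoc (c *ℤ pos (atom α a b)) _ _))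

    ⟦scaled⟧ : ∀ c R a b → ⟦ map (c ,_) R ⟧ a b ≡ c *ℤ pos (Σatoms R a b)
    ⟦scaled⟧ c []      a b = sym (ℤP.*-zeroʳ c)
    ⟦scaled⟧ c (α ∷ R) a b = begin
      c *ℤ pos (atom α a b) +ℤ ⟦ map (c ,_) R ⟧ a b       ≡⟨ cong (value (c , α) a b +ℤ_) (⟦scaled⟧ c R a b) ⟩
      c *ℤ pos (atom α a b) +ℤ c *ℤ pos (Σatoms R a b)    ≡⟨ ℤP.*-distribˡ-+ c (pos (atom α a b)) _ ⟨
      c *ℤ (pos (atom α a b) +ℤ pos (Σatoms R a b))       ≡⟨ cong (c *ℤ_) (ℤP.pos-+ (atom α a b) _) ⟨
      c *ℤ pos (Σatoms (α ∷ R) a b)                       ∎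
      where open ≡-Reasoning

    expandAt : (ℕ → List Atom) → ℕ → List Term → List Term
    expandAt rule k []                       = []
    expandAt rule k ((c , i , j , k′) ∷ L) with k′ ≟ k
    ... | yes _ = map (c ,_) (shiftAtoms i j (rule k)) ++ expandAt rule k L
    ... | no  _ = (c , i , j , k′) ∷ expandAt rule k L

    expandAt-sound : ∀ rule k → A k ≈ Σatoms (rule k) → ∀ L a b → ⟦ expandAt rule k L ⟧ a b ≡ ⟦ L ⟧ a b
    expandAt-sound rule k relation []                     a b = refl
    expandAt-sound rule k relation ((c , i , j , k′) ∷ L) a b with k′ ≟ k
    ... | no  _    = cong (value (c , i , j , k′) a b +ℤ_) (expandAt-sound rule k relation L a b)
    ... | yes refl = begin
      ⟦ map (c ,_) (shiftAtoms i j (rule k)) ++ expandAt rule k L ⟧ a b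
        ≡⟨ ⟦++⟧ (map (c ,_) (shiftAtoms i j (rule k))) _ a b ⟩
      ⟦ map (c ,_) (shiftAtoms i j (rule k)) ⟧ a b +ℤ ⟦ expandAt rule k L ⟧ a b
        ≡⟨ cong₂ _+ℤ_ (⟦scaled⟧ c (shiftAtoms i j (rule k)) a b) (expandAt-sound rule k relation L a b) ⟩
      c *ℤ pos (Σatoms (shiftAtoms i j (rule k)) a b) +ℤ ⟦ L ⟧ a b
        ≡⟨ cong (λ v → c *ℤ pos v +ℤ ⟦ L ⟧ a b) (trans (mono-cong i j relation a b) (mono-Σatoms i j (rule k) a b)) ⟨
      c *ℤ pos (mono i j (A k) a b) +ℤ ⟦ L ⟧ a b
        ∎
      where open ≡-Reasoning

    eliminate : (ℕ → List Atom) → List ℕ → List Term → List Term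
    eliminate rule []       L = L
    eliminate rule (k ∷ ks) L = eliminate rule ks (expandAt rule k L)

    eliminate-sound : ∀ rule → (∀ k → A k ≈ Σatoms (rule k)) → ∀ ks L a b → ⟦ eliminate rule ks L ⟧ a b ≡ ⟦ L ⟧ a b
    eliminate-sound rule relations []       L a b = refl
    eliminate-sound rule relations (k ∷ ks) L a b =
      trans (eliminate-sound rule relations ks (expandAt rule k L) a b) (expandAt-sound rule k (relations k) L a b)

    insert : Term → List Term → List Term
    insert t                []              = t ∷ []
    insert (c , α) ((c′ , α′) ∷ L) with ≡-dec _≟_ (≡-dec _≟_ _≟_) α α′
    ... | yes _ = (c +ℤ c′ , α) ∷ L
    ... | no  _ = (c′ , α′) ∷ insert (c , α) L

    collect : List Term → List Term
    collect []      = []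
    collect (t ∷ L) = insert t (collect L)

    insert-sound : ∀ c α L a b → ⟦ insert (c , α) L ⟧ a b ≡ c *ℤ pos (atom α a b) +ℤ ⟦ L ⟧ a b
    insert-sound c α []               a b = refl
    insert-sound c α ((c′ , α′) ∷ L) a b with ≡-dec _≟_ (≡-dec _≟_ _≟_) α α′
    ... | yes refl = trans (cong (_+ℤ ⟦ L ⟧ a b) (ℤP.*-distribʳ-+ (pos (atom α a b)) c c′))
                           (ℤP.+-assoc (c *ℤ pos (atom α a b)) _ _)
    ... | no  _    = trans (cong (value (c′ , α′) a b +ℤ_) (insert-sound c α L a b))
                           (swap (c′ *ℤ pos (atom α′ a b)) (c *ℤ pos (atom α a b)) (⟦ L ⟧ a b))
      where
      swap : ∀ u v w → u +ℤ (v +ℤ w) ≡ v +ℤ (u +ℤ w)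
      swap = ℤ-Solver.solve-∀

    collect-sound : ∀ L a b → ⟦ collect L ⟧ a b ≡ ⟦ L ⟧ a b
    collect-sound []            a b = refl
    collect-sound ((c , α) ∷ L) a b = trans (insert-sound c α (collect L) a b) (cong (value (c , α) a b +ℤ_) (collect-sound L a b))

    vanishing : ∀ L → All (λ t → proj₁ t ≡ 0ℤ) L → ∀ a b → ⟦ L ⟧ a b ≡ 0ℤ
    vanishing []            []         a b = refl
    vanishing ((c , α) ∷ L) (refl ∷ z) a b = trans (ℤP.+-identityˡ (⟦ L ⟧ a b)) (vanishing L z a b)

    relation-by-elimination : ∀ rule → (∀ k → A k ≈ Σatoms (rule k)) → ∀ ks L →
      All (λ t → proj₁ t ≡ 0ℤ) (collect (eliminate rule ks L)) → ∀ a b → ⟦ L ⟧ a b ≡ 0ℤ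
    relation-by-elimination rule relations ks L zero-coeffs a b =
      trans (sym (eliminate-sound rule relations ks L a b))
            (trans (sym (collect-sound (eliminate rule ks L) a b)) (vanishing _ zero-coeffs a b))

  open LinearRelations Asc

  continuationFor : ℕ → ℕ → List Atom
  continuationFor 0 k = (0 , 0 , 2 + k) ∷ []
  continuationFor 1 k = (1 , k , 3 + k) ∷ (0 , 0 , 2 + k) ∷ []
  continuationFor _ k = (1 , 1 + k , 3 + k) ∷ (1 , 2 + k , 4 + k) ∷ (0 , 0 , 3 + k) ∷ []

  continuation : ℕ → List Atom
  continuation k = continuationFor (k % 3) k

  continuation-sound : ∀ k → Cont k 0 ≈ Σatoms (continuation k)
  continuation-sound k m n with k % 3 in k%3 | m%n<n k 3
  ... | 0 | _ = trans (cont₀ k k%3 m n) (sym (+-identityʳ _))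
  ... | 1 | _ = trans (cont₁ k k%3 m n) (cong (mono 1 k (Asc (3 + k)) m n +_) (sym (+-identityʳ _)))
  ... | 2 | _ = trans (cont₂ k k%3 m n) (cong (λ v → mono 1 (1 + k) (Asc (3 + k)) m n + (mono 1 (2 + k) (Asc (4 + k)) m n + v)) (sym (+-identityʳ _)))
  ... | suc (suc (suc _)) | s≤s (s≤s (s≤s ()))

  recurrence : ℕ → List Atom
  recurrence k = (0 , 0 , 1 + k) ∷ shiftAtoms 1 k (continuation k)

  recurrence-sound : ∀ k → Asc k ≈ Σatoms (recurrence k)
  recurrence-sound k m n =
    trans (split k m n) (cong (Asc (1 + k) m n +_) (trans (mono-cong 1 k (continuation-sound k) m n) (mono-Σatoms 1 k (continuation k) m n)))

  shiftCoef≡Asc : ∀ t m n → shiftCoef (t * 3) m n ≡ pos (Asc (t * 3 + 2) m n)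
  shiftCoef≡Asc t m n rewrite *-comm (t * 3) m | Asc-dilated t m n with m * (t * 3) ≤ᵇ n
  ... | true  = cong pos (gCoef≡Asc m (n ∸ m * (t * 3)))
  ... | false = refl

  times : Poly → ℕ → List Term
  times p k = map (λ (c , i , j) → (c , i , j , k)) p

  prodCoef≡ : ∀ p t a b → prodCoef p (t * 3) a b ≡ ⟦ times p (t * 3 + 2) ⟧ a b
  prodCoef≡ []              t a b = refl
  prodCoef≡ ((c , i , j) ∷ p) t a b = cong₂ _+ℤ_ monomial (prodCoef≡ p t a b)
    where
    monomial : (if (i ≤ᵇ a) ∧ (j ≤ᵇ b) then c *ℤ shiftCoef (t * 3) (a ∸ i) (b ∸ j) else 0ℤ)
                 ≡ c *ℤ pos (mono i j (Asc (t * 3 + 2)) a b)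
    monomial with (i ≤ᵇ a) ∧ (j ≤ᵇ b)
    ... | true  = cong (c *ℤ_) (shiftCoef≡Asc t (a ∸ i) (b ∸ j))
    ... | false = sym (ℤP.*-zeroʳ c)

  functionalEquation : List Term
  functionalEquation = ((times p₀ 2 ++ times p₃ 5) ++ times p₆ 8) ++ times p₉ 11

  -- Eliminating A₂, A₃, A₄, A₅, A₆, A₇, A₉ by the recurrences leaves no term at all
  -- (checked by evaluation), so the combination vanishes.
  functionalEquation-holds : ∀ a b → ⟦ functionalEquation ⟧ a b ≡ 0ℤ
  functionalEquation-holds =
    relation-by-elimination recurrence recurrence-sound eliminated functionalEquation
      (toWitness {a? = all? (λ t → proj₁ t ℤ.≟ 0ℤ) (collect (eliminate recurrence eliminated functionalEquation))} tt)
    where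
    eliminated : List ℕ
    eliminated = 2 ∷ 3 ∷ 4 ∷ 5 ∷ 6 ∷ 7 ∷ 9 ∷ []


open import Defs
open import Data.Nat using (ℕ)
open import Data.Integer using (0ℤ; _+_)
open import Data.List using (_++_)
open import Relation.Binary.PropositionalEquality using (_≡_; refl; cong₂; module ≡-Reasoning)
open Proof using (Asc; times; prodCoef≡; functionalEquation; functionalEquation-holds; module LinearRelations)
open LinearRelations Asc using (⟦_⟧; ⟦++⟧)

mainTheorem10 : (a b : ℕ) → prodCoef p₀ 0 a b + prodCoef p₃ 3 a b + prodCoef p₆ 6 a b + prodCoef p₉ 9 a b ≡ 0ℤ
mainTheorem10 a b = begin
  prodCoef p₀ 0 a b + prodCoef p₃ 3 a b + prodCoef p₆ 6 a b + prodCoef p₉ 9 a b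
    ≡⟨ cong₂ _+_ (cong₂ _+_ (cong₂ _+_ (prodCoef≡ p₀ 0 a b) (prodCoef≡ p₃ 1 a b)) (prodCoef≡ p₆ 2 a b)) (prodCoef≡ p₉ 3 a b) ⟩
  ⟦ times p₀ 2 ⟧ a b + ⟦ times p₃ 5 ⟧ a b + ⟦ times p₆ 8 ⟧ a b + ⟦ times p₉ 11 ⟧ a b
    ≡⟨ cong₂ _+_ (cong₂ _+_ (⟦++⟧ (times p₀ 2) (times p₃ 5) a b) refl) refl ⟨
  ⟦ times p₀ 2 ++ times p₃ 5 ⟧ a b + ⟦ times p₆ 8 ⟧ a b + ⟦ times p₉ 11 ⟧ a b
    ≡⟨ cong₂ _+_ (⟦++⟧ (times p₀ 2 ++ times p₃ 5) (times p₆ 8) a b) refl ⟨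
  ⟦ (times p₀ 2 ++ times p₃ 5) ++ times p₆ 8 ⟧ a b + ⟦ times p₉ 11 ⟧ a b
    ≡⟨ ⟦++⟧ ((times p₀ 2 ++ times p₃ 5) ++ times p₆ 8) (times p₉ 11) a b ⟨
  ⟦ functionalEquation ⟧ a b
    ≡⟨ functionalEquation-holds a b ⟩
  0ℤ
    ∎
  where open ≡-Reasoning
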